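{- Let $k\ge2$ be an integer and let $r(k)$ be a representation of $k$ with respect to the sequence $F_2,F_3,F_4,\ldots=2,3,5,\ldots$ that satisfies Property 1 and Property 2. Then $r(k)$ equals the greedy representation of $k$.
   Context: $(F_n)_{n\ge0}$ is the Fibonacci sequence with $F_0=F_1=1$, $F_{n+1}=F_n+F_{n-1}$. A representation of a positive integer $k$ with respect to $F_2,F_3,\ldots$ is a finite multiset of terms $F_j$ ($j\ge2$) summing to $k$. The greedy representation of $k\ge 2$ is obtained by processing the terms $F_j\le k$ in decreasing order of $j$: for the current $F_j$, take $F_j$ the largest number $q\ge0$ of times such that the remainder $k-qF_j$ is $0$ or at least $2$, then replace $k$ by the remainder and continue with $F_{j-1}$, until the remainder is $0$. A representation has Property 1 if it does not contain two consecutive Fibonacci numbers $F_j$ and $F_{j+1}$. It has Property 2 if no $F_j$ appears twice or more, except that $F_2=2$ or $F_3=3$ may appear twice, but not both simultaneously. -}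

module Defs where

open import Data.Nat using (ℕ; zero; suc; _+_; _*_; _∸_; _≤_; _≤?_; _≟_)
open import Data.Bool using (Bool; true; false; if_then_else_; _∨_)
open import Relation.Nullary.Decidable using (⌊_⌋)
open import Relation.Nullary using (¬_)
open import Relation.Binary.PropositionalEquality using (_≡_)
open import Data.Product using (_×_)

F : ℕ → ℕ
F zero = 1
F (suc zero) = 1
F (suc (suc n)) = F (suc n) + F n

sumTo : ℕ → (ℕ → ℕ) → ℕ
sumTo zero f = 0
sumTo (suc N) f = sumTo N f + f N

admissible : ℕ → Bool
admissible zero = true
admissible (suc zero) = false
admissible (suc (suc _)) = true

validQ : ℕ → ℕ → ℕ → Bool
validQ f k q = if ⌊ q * f ≤? k ⌋ then admissible (k ∸ q * f) else false

-- largest q ≤ c with validQ f k q (0 is always valid when k ≠ 1)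
maxQ : ℕ → ℕ → ℕ → ℕ
maxQ f k zero = zero
maxQ f k (suc c) = if validQ f k (suc c) then suc c else maxQ f k c

-- largest number q ≥ 0 of copies of f that may be taken from k
-- (q ≤ k since f ≥ 1 for Fibonacci numbers)
takeCount : ℕ → ℕ → ℕ
takeCount f k = maxQ f k k

-- greedy processing of F j, F (j-1), …, F 2 starting with remainder r;
-- result: multiplicity of each F i
greedyFrom : ℕ → ℕ → (ℕ → ℕ)
greedyFrom zero r = λ _ → 0
greedyFrom (suc zero) r = λ _ → 0
greedyFrom (suc (suc n)) r i =
  if ⌊ i ≟ suc (suc n) ⌋ then q else greedyFrom (suc n) (r ∸ q * F (suc (suc n))) i
  where q = takeCount (F (suc (suc n))) r

-- greedy representation of k: starting from index k + 1 (F (k+1) > k, so all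
-- terms F j ≤ k are processed; larger ones get multiplicity 0)
greedy : ℕ → (ℕ → ℕ)
greedy k = greedyFrom (suc k) k

-- a representation: multiplicity function m (m j = number of copies of F j),
-- only indices j ≥ 2, finite support below N, summing to k
record IsRepresentation (k N : ℕ) (m : ℕ → ℕ) : Set where
  field
    no-F0   : m 0 ≡ 0
    no-F1   : m 1 ≡ 0
    support : ∀ j → N ≤ j → m j ≡ 0
    sums    : sumTo N (λ j → m j * F j) ≡ k

Property1 : (ℕ → ℕ) → Set
Property1 m = ∀ j → ¬ (1 ≤ m j × 1 ≤ m (suc j))

Property2 : (ℕ → ℕ) → Set
Property2 m = (∀ j → 4 ≤ j → m j ≤ 1) × m 2 ≤ 2 × m 3 ≤ 2 × ¬ (m 2 ≡ 2 × m 3 ≡ 2)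

-- Write v(n) for the value of the terms F j with j < n. Properties 1 and 2 give the
-- Zeckendorf-type bound: v(n) < F n or v(n) = F n + 1 (the second case starts from
-- 2 + 2 and 3 + 3 and propagates through F n + F (n + 1) = F (n + 2)). When the greedy
-- algorithm reaches F t its remainder is v(t + 1) = v(t) + m t * F t; taking m t copies
-- leaves v(t), which is 0 or ≥ 2, while one more copy would leave a negative number or 1.
-- So greedy takes exactly m t copies and continues with v(t); induction on t concludes.
module Submission where

open import Defs
open import Data.Nat
open import Data.Nat.Properties
open import Data.Bool using (true; false)
open import Data.Empty using (⊥-elim)
open import Data.Product using (_,_; proj₁; proj₂)
open import Data.Sum using (_⊎_; inj₁; inj₂)
open import Relation.Nullary using (yes; no)
open import Relation.Binary.PropositionalEquality

1≤F : ∀ n → 1 ≤ F n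
1≤F zero = s≤s z≤n
1≤F (suc zero) = s≤s z≤n
1≤F (suc (suc n)) = ≤-trans (1≤F (suc n)) (m≤m+n _ _)

2≤F[2+n] : ∀ n → 2 ≤ F (suc (suc n))
2≤F[2+n] n = +-mono-≤ (1≤F (suc n)) (1≤F n)

n≤F[n] : ∀ n → n ≤ F n
n≤F[n] zero = z≤n
n≤F[n] (suc zero) = s≤s z≤n
n≤F[n] (suc (suc n)) = subst (_≤ F (suc n) + F n) (+-comm (suc n) 1)
  (+-mono-≤ (n≤F[n] (suc n)) (1≤F n))

≤-sumTo : ∀ {f : ℕ → ℕ} {n j} → j < n → f j ≤ sumTo n f
≤-sumTo {f} {suc n} {j} j<1+n with m≤n⇒m<n∨m≡n (≤-pred j<1+n)
... | inj₁ j<n = ≤-trans (≤-sumTo j<n) (m≤m+n _ _)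
... | inj₂ refl = m≤n+m _ _

sumTo-vanishing : ∀ {f : ℕ → ℕ} {L n} → (∀ j → L ≤ j → f j ≡ 0) → L ≤′ n →
  sumTo n f ≡ sumTo L f
sumTo-vanishing vanish ≤′-refl = refl
sumTo-vanishing {f} {L} {suc n} vanish (≤′-step L≤′n) = begin
  sumTo n f + f n  ≡⟨ cong (sumTo n f +_) (vanish n (≤′⇒≤ L≤′n)) ⟩
  sumTo n f + 0    ≡⟨ +-identityʳ _ ⟩
  sumTo n f        ≡⟨ sumTo-vanishing vanish L≤′n ⟩
  sumTo L f        ∎
  where open ≡-Reasoning

sumTo-support-independent : ∀ {f : ℕ → ℕ} {L L′} →
  (∀ j → L ≤ j → f j ≡ 0) → (∀ j → L′ ≤ j → f j ≡ 0) → sumTo L f ≡ sumTo L′ f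
sumTo-support-independent {L = L} {L′} vanish vanish′ with ≤-total L L′
... | inj₁ L≤L′ = sym (sumTo-vanishing vanish (≤⇒≤′ L≤L′))
... | inj₂ L′≤L = sumTo-vanishing vanish′ (≤⇒≤′ L′≤L)

admissible-+ : ∀ a b → admissible a ≡ true → admissible b ≡ true → admissible (a + b) ≡ true
admissible-+ zero b _ adm-b = adm-b
admissible-+ (suc (suc a)) b _ _ = refl

admissible-* : ∀ x {f} → 2 ≤ f → admissible (x * f) ≡ true
admissible-* zero _ = refl
admissible-* (suc x) (s≤s (s≤s _)) = refl

NoRoomFor : ℕ → ℕ → Set
NoRoomFor f s = s < f ⊎ s ≡ suc f

noRoom-next : ∀ {n v} → NoRoomFor (F (suc (suc (suc n)))) v → v < F (suc (suc (suc (suc n))))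
noRoom-next {n} (inj₁ v<F) = ≤-trans v<F (m≤m+n _ _)
noRoom-next {n} (inj₂ refl) = subst (_≤ F (suc (suc (suc n))) + F (suc (suc n)))
  (+-comm (F (suc (suc (suc n)))) 2) (+-monoʳ-≤ (F (suc (suc (suc n)))) (2≤F[2+n] n))

noRoom-add : ∀ {n v} → NoRoomFor (F n) v → NoRoomFor (F (suc (suc n))) (v + F (suc n))
noRoom-add {n} {v} (inj₁ v<F) =
  inj₁ (subst (suc (v + F (suc n)) ≤_) (+-comm (F n) (F (suc n))) (+-monoˡ-≤ (F (suc n)) v<F))
noRoom-add {n} (inj₂ refl) = inj₂ (cong suc (+-comm (F n) (F (suc n))))

validQ-shift : ∀ f s e q → validQ f (e * f + s) (e + q) ≡ validQ f s q
validQ-shift f s e q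
  rewrite *-distribʳ-+ f e q | [m+n]∸[m+o]≡n∸o (e * f) s (q * f)
  with q * f ≤? s | e * f + q * f ≤? e * f + s
... | yes _ | yes _ = refl
... | no _ | no _ = refl
... | yes qf≤s | no qf≰s = ⊥-elim (qf≰s (+-monoʳ-≤ (e * f) qf≤s))
... | no qf≰s | yes qf≤s = ⊥-elim (qf≰s (+-cancelˡ-≤ (e * f) _ _ qf≤s))

validQ-noRoom : ∀ {f s} d → 2 ≤ f → NoRoomFor f s → validQ f s (suc d) ≡ false
validQ-noRoom {f} {s} d 2≤f noRoom with f + d * f ≤? s
... | no _ = refl
... | yes fits = overshoot d noRoom fits
  where
  overshoot : ∀ {s} d → NoRoomFor f s → f + d * f ≤ s → admissible (s ∸ (f + d * f)) ≡ false
  overshoot d (inj₁ s<f) fits = ⊥-elim (<⇒≱ s<f (≤-trans (m≤m+n f (d * f)) fits))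
  overshoot zero (inj₂ refl) _ rewrite +-identityʳ f = cong admissible (m+n∸n≡m 1 f)
  overshoot (suc d) (inj₂ refl) fits = ⊥-elim (<⇒≱ 2≤f (+-cancelˡ-≤ f f 1
    (≤-trans (+-monoʳ-≤ f (m≤m+n f (d * f))) (subst (f + (f + d * f) ≤_) (+-comm 1 f) fits))))

maxQ-unique : ∀ f k c e → e ≤ c → validQ f k e ≡ true →
  (∀ q → e < q → validQ f k q ≡ false) → maxQ f k c ≡ e
maxQ-unique f k zero .zero z≤n _ _ = refl
maxQ-unique f k (suc c) e e≤1+c valid-e invalid-above with m≤n⇒m<n∨m≡n e≤1+c
... | inj₁ e<1+c rewrite invalid-above (suc c) e<1+c =
  maxQ-unique f k c e (≤-pred e<1+c) valid-e invalid-above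
... | inj₂ refl rewrite valid-e = refl

takeCount-exact : ∀ {f s} e → 2 ≤ f → admissible s ≡ true → NoRoomFor f s →
  takeCount f (s + e * f) ≡ e
takeCount-exact {f} {s} e 2≤f adm-s noRoom rewrite +-comm s (e * f) =
  maxQ-unique f (e * f + s) (e * f + s) e e≤k valid-e invalid-above
  where
  e≤k : e ≤ e * f + s
  e≤k = ≤-trans (m≤m*n e f {{>-nonZero (≤-trans (s≤s z≤n) 2≤f)}}) (m≤m+n _ s)
  valid-e : validQ f (e * f + s) e ≡ true
  valid-e = trans (subst (λ q → validQ f (e * f + s) q ≡ validQ f s 0) (+-identityʳ e)
    (validQ-shift f s e 0)) adm-s
  invalid-above : ∀ q → e < q → validQ f (e * f + s) q ≡ false
  invalid-above q e<q with q ∸ e in q∸e≡ | m<n⇒0<n∸m e<q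
  ... | suc d | _ = begin
    validQ f (e * f + s) q            ≡⟨ cong (validQ f (e * f + s)) (sym (m+[n∸m]≡n (<⇒≤ e<q))) ⟩
    validQ f (e * f + s) (e + (q ∸ e)) ≡⟨ validQ-shift f s e (q ∸ e) ⟩
    validQ f s (q ∸ e)                ≡⟨ cong (validQ f s) q∸e≡ ⟩
    validQ f s (suc d)                ≡⟨ validQ-noRoom d 2≤f noRoom ⟩
    false                             ∎
    where open ≡-Reasoning

greedyFrom-top : ∀ n r → greedyFrom (suc (suc n)) r (suc (suc n)) ≡ takeCount (F (suc (suc n))) r
greedyFrom-top n r with suc (suc n) ≟ suc (suc n)
... | yes _ = refl
... | no t≢t = ⊥-elim (t≢t refl)

greedyFrom-below : ∀ n r i → i ≢ suc (suc n) →
  greedyFrom (suc (suc n)) r i ≡ greedyFrom (suc n) (r ∸ takeCount (F (suc (suc n))) r * F (suc (suc n))) i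
greedyFrom-below n r i i≢t with i ≟ suc (suc n)
... | yes i≡t = ⊥-elim (i≢t i≡t)
... | no _ = refl

greedyFrom-beyond : ∀ n r i → n < i → greedyFrom n r i ≡ 0
greedyFrom-beyond zero r i _ = refl
greedyFrom-beyond (suc zero) r i _ = refl
greedyFrom-beyond (suc (suc n)) r i n<i =
  trans (greedyFrom-below n r i (>⇒≢ n<i)) (greedyFrom-beyond (suc n) _ i (<-trans (n<1+n _) n<i))

value : (ℕ → ℕ) → ℕ → ℕ
value m n = sumTo n (λ j → m j * F j)

value-support-independent : ∀ {m L L′} →
  (∀ j → L ≤ j → m j ≡ 0) → (∀ j → L′ ≤ j → m j ≡ 0) → value m L ≡ value m L′
value-support-independent {m} vanish vanish′ = sumTo-support-independent {f = λ j → m j * F j}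
  (λ j L≤j → cong (_* F j) (vanish j L≤j)) (λ j L′≤j → cong (_* F j) (vanish′ j L′≤j))

module _ (m : ℕ → ℕ) (no-F0 : m 0 ≡ 0) (no-F1 : m 1 ≡ 0)
         (property1 : Property1 m) (property2 : Property2 m) where

  value-admissible : ∀ n → admissible (value m n) ≡ true
  value-admissible zero = refl
  value-admissible (suc n) = admissible-+ (value m n) (m n * F n) (value-admissible n) (term-admissible n)
    where
    term-admissible : ∀ j → admissible (m j * F j) ≡ true
    term-admissible zero rewrite no-F0 = refl
    term-admissible (suc zero) rewrite no-F1 = refl
    term-admissible (suc (suc j)) = admissible-* (m (suc (suc j))) (2≤F[2+n] j)

  empty-below-occupied : ∀ j → 1 ≤ m (suc j) → m j ≡ 0
  empty-below-occupied j occupied = n<1⇒n≡0 (≰⇒> (λ 1≤m[j] → property1 j (1≤m[j] , occupied)))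

  value-bound-occupied : ∀ n c → m (suc (suc (suc n))) ≡ suc c →
    NoRoomFor (F (suc (suc n))) (value m (suc (suc n))) →
    NoRoomFor (F (suc (suc (suc (suc n))))) (value m (suc (suc n)) + suc c * F (suc (suc (suc n))))
  value-bound-occupied zero zero _ _ rewrite no-F0 | no-F1 = inj₁ (s≤s (s≤s (s≤s (s≤s z≤n))))
  value-bound-occupied zero (suc zero) _ _ rewrite no-F0 | no-F1 = inj₂ refl
  value-bound-occupied zero (suc (suc c)) m[3]≡ _
    with subst (_≤ 2) m[3]≡ (proj₁ (proj₂ (proj₂ property2)))
  ... | s≤s (s≤s ())
  value-bound-occupied (suc n) zero _ bound rewrite *-identityˡ (F (suc (suc (suc (suc n))))) =
    noRoom-add {suc (suc (suc n))} bound
  value-bound-occupied (suc n) (suc c) m[t]≡ _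
    with subst (_≤ 1) m[t]≡ (proj₁ property2 _ (s≤s (s≤s (s≤s (s≤s z≤n)))))
  ... | s≤s ()

  value-bound-step : ∀ n →
    NoRoomFor (F (suc (suc (suc n)))) (value m (suc (suc (suc n)))) →
    NoRoomFor (F (suc (suc n))) (value m (suc (suc n))) →
    NoRoomFor (F (suc (suc (suc (suc n))))) (value m (suc (suc (suc (suc n)))))
  value-bound-step n bound₃ bound₂ with m (suc (suc (suc n))) in m[t]≡
  ... | zero = inj₁ (subst (_< F (suc (suc (suc (suc n))))) (sym (+-identityʳ _)) (noRoom-next {n} bound₃))
  ... | suc c rewrite empty-below-occupied (suc (suc n)) (subst (1 ≤_) (sym m[t]≡) (s≤s z≤n))
                    | +-identityʳ (value m (suc (suc n))) = value-bound-occupied n c m[t]≡ bound₂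

  value-bound : ∀ n → NoRoomFor (F n) (value m n)
  value-bound zero = inj₁ (s≤s z≤n)
  value-bound (suc zero) rewrite no-F0 = inj₁ (s≤s z≤n)
  value-bound (suc (suc zero)) rewrite no-F0 | no-F1 = inj₁ (s≤s z≤n)
  value-bound (suc (suc (suc zero))) rewrite no-F0 | no-F1 with m 2 | proj₁ (proj₂ property2)
  ... | 0 | _ = inj₁ (s≤s z≤n)
  ... | 1 | _ = inj₁ (s≤s (s≤s (s≤s z≤n)))
  ... | 2 | _ = inj₂ refl
  ... | suc (suc (suc _)) | s≤s (s≤s ())
  value-bound (suc (suc (suc (suc n)))) =
    value-bound-step n (value-bound (suc (suc (suc n)))) (value-bound (suc (suc n)))

  takeCount-value : ∀ n → takeCount (F (suc (suc n))) (value m (suc (suc (suc n)))) ≡ m (suc (suc n))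
  takeCount-value n = takeCount-exact (m (suc (suc n))) (2≤F[2+n] n)
    (value-admissible (suc (suc n))) (value-bound (suc (suc n)))

  greedyFrom-value-step : ∀ n →
    (∀ i → i ≤ suc n → m i ≡ greedyFrom (suc n) (value m (suc (suc n))) i) →
    ∀ i → i ≤ suc (suc n) → m i ≡ greedyFrom (suc (suc n)) (value m (suc (suc (suc n)))) i
  greedyFrom-value-step n recovered i i≤t with m≤n⇒m<n∨m≡n i≤t
  ... | inj₂ refl = sym (trans (greedyFrom-top n r) (takeCount-value n))
    where r = value m (suc (suc (suc n)))
  ... | inj₁ i<t = begin
    m i                                          ≡⟨ recovered i (≤-pred i<t) ⟩
    greedyFrom (suc n) (value m (suc (suc n))) i ≡⟨ cong (λ r → greedyFrom (suc n) r i) remainder≡ ⟨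
    greedyFrom (suc n) (r ∸ q * F (suc (suc n))) i ≡⟨ greedyFrom-below n r i (<⇒≢ i<t) ⟨
    greedyFrom (suc (suc n)) r i                 ∎
    where
    open ≡-Reasoning
    r = value m (suc (suc (suc n)))
    q = takeCount (F (suc (suc n))) r
    remainder≡ : r ∸ q * F (suc (suc n)) ≡ value m (suc (suc n))
    remainder≡ rewrite takeCount-value n = m+n∸n≡m (value m (suc (suc n))) (m (suc (suc n)) * F (suc (suc n)))

  greedyFrom-value : ∀ n i → i ≤ n → m i ≡ greedyFrom n (value m (suc n)) i
  greedyFrom-value zero .zero z≤n = no-F0
  greedyFrom-value (suc zero) zero _ = no-F0
  greedyFrom-value (suc zero) (suc zero) _ = no-F1
  greedyFrom-value (suc zero) (suc (suc i)) (s≤s ())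
  greedyFrom-value (suc (suc n)) = greedyFrom-value-step n (greedyFrom-value (suc n))

module _ {k N : ℕ} {m : ℕ → ℕ} (rep : IsRepresentation k N m) where
  open IsRepresentation rep

  representation-vanishes-above : ∀ j → k < j → m j ≡ 0
  representation-vanishes-above j k<j with N ≤? j
  ... | yes N≤j = support j N≤j
  ... | no N≰j = n<1⇒n≡0 (*-cancelʳ-< _ (m j) 1 (begin-strict
    m j * F j                       ≤⟨ ≤-sumTo {f = λ i → m i * F i} (≰⇒> N≰j) ⟩
    sumTo N (λ i → m i * F i)       ≡⟨ sums ⟩
    k                               <⟨ k<j ⟩
    j                               ≤⟨ n≤F[n] j ⟩
    F j                             ≡⟨ +-identityʳ (F j) ⟨
    1 * F j                         ∎))
    where open ≤-Reasoning

  representation-value : value m (suc (suc k)) ≡ k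
  representation-value = trans
    (value-support-independent (λ j 2+k≤j → representation-vanishes-above j (<⇒≤ 2+k≤j)) support)
    sums

lemma8 : (k N : ℕ) (m : ℕ → ℕ) → 2 ≤ k → IsRepresentation k N m →
    Property1 m → Property2 m → ∀ j → m j ≡ greedy k j
lemma8 k N m _ rep property1 property2 j with j ≤? suc k
... | yes j≤1+k = trans (greedyFrom-value m no-F0 no-F1 property1 property2 (suc k) j j≤1+k)
                        (cong (λ r → greedyFrom (suc k) r j) (representation-value rep))
  where open IsRepresentation rep
... | no j≰1+k = trans (representation-vanishes-above rep j (<⇒≤ (≰⇒> j≰1+k)))
                       (sym (greedyFrom-beyond (suc k) k j (≰⇒> j≰1+k)))
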